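{- For every complemented HMS model $\overline{\mathsf{M}}$, its FH-transform $FH(\overline{\mathsf{M}})$ is an FH model for $\mathsf{At}$ (i.e., a partitional and propositionally determined FH model).
   Context: Fix a nonempty set $\mathsf{At}$ of atoms. Lattice and HMS notions: nonempty pairwise disjoint spaces $S_\Phi$ ($\Phi \subseteq \mathsf{At}$), ordered $S_\Psi \preceq S_\Phi$ iff $\Psi \subseteq \Phi$; $\Omega := \bigcup_\Phi S_\Phi$; surjections $r^\Phi_\Psi : S_\Phi \to S_\Psi$ ($\Psi \subseteq \Phi$), $r^\Phi_\Phi$ identity, $r^\Phi_\Upsilon = r^\Psi_\Upsilon \circ r^\Phi_\Psi$; $\omega_\Psi := r^\Phi_\Psi(\omega)$; $D_\Psi := r^\Phi_\Psi(D)$, $D_S := D_\Psi$ for $S = S_\Psi$; $D^\uparrow := \bigcup_{\Phi \subseteq \Psi}(r^\Psi_\Phi)^{ -1}(D)$ for $D \subseteq S_\Phi$; events are the sets $D^\uparrow$. A complemented HMS model $\langle I, \{S_\Phi\}, (r^\Phi_\Psi), (\Lambda_i)_{i \in I}, (\Pi_i)_{i \in I}, v\rangle$ has a nonempty set $I$, a valuation $v$ from atoms to events, $\Pi_i : \Omega \to 2^\Omega \setminus \{\emptyset\}$ with Confinement (if $\omega \in S_\Phi$ then $\Pi_i(\omega) \subseteq S_\Psi$ for some $\Psi \subseteq \Phi$), Generalized Reflexivity ($\omega \in (\Pi_i(\omega))^\uparrow$), Stationarity ($\omega' \in \Pi_i(\omega) \Rightarrow \Pi_i(\omega') = \Pi_i(\omega)$),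 Projections Preserve Ignorance ($\omega \in S_\Phi$, $\Psi \subseteq \Phi \Rightarrow (\Pi_i(\omega))^\uparrow \subseteq (\Pi_i(\omega_\Psi))^\uparrow$), Projections Preserve Knowledge ($\Upsilon \subseteq \Psi \subseteq \Phi$, $\omega \in S_\Phi$, $\Pi_i(\omega) \subseteq S_\Psi \Rightarrow (\Pi_i(\omega))_\Upsilon = \Pi_i(\omega_\Upsilon)$); and $\Lambda_i : \Omega \to 2^\Omega$ with Reflexivity, Stationarity ($\omega' \in \Lambda_i(\omega) \Rightarrow \Lambda_i(\omega') = \Lambda_i(\omega)$), Projections Preserve Implicit Knowledge ($\omega \in S_\Phi \Rightarrow \Lambda_i(\omega)_\Psi = \Lambda_i(\omega_\Psi)$ for $\Psi \subseteq \Phi$), Explicit Measurability ($\omega' \in \Lambda_i(\omega) \Rightarrow \Pi_i(\omega') = \Pi_i(\omega)$), Implicit Measurability ($\omega' \in \Pi_i(\omega) \Rightarrow \Lambda_i(\omega') = \Lambda_i(\omega)_{S_{\Pi_i(\omega)}}$, where $S_{\Pi_i(\omega)}$ is the space containing $\Pi_i(\omega)$). Language $\mathcal{L}_{\mathsf{At}}$: $\varphi ::= \top \mid p \mid \neg\varphi \mid \varphi\wedge\psi \mid \ell_i\varphi \mid a_i\varphi \mid k_i\varphi$; $\mathsf{At}(\varphi)$ the atoms in $\varphi$; $\mathcal{L}_\Phi := \{\varphi : \mathsf{At}(\varphi) \subseteq \Phi\}$. An FH model for $\mathsf{At}$ is $\langle I, W, (R_i), (\mathcal{A}_i), V\rangle$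 with $W$ nonempty, each $R_i$ an equivalence relation on $W$, $\mathcal{A}_i : W \to 2^{\mathcal{L}_{\mathsf{At}}}$ satisfying $\varphi \in \mathcal{A}_i(w)$ iff $p \in \mathcal{A}_i(w)$ for all $p \in \mathsf{At}(\varphi)$, and $(w,t) \in R_i \Rightarrow \mathcal{A}_i(w) = \mathcal{A}_i(t)$; and $V : \mathsf{At} \to 2^W$. The FH-transform $FH(\overline{\mathsf{M}}) = \langle I, W_{\mathsf{At}}, (R_{\mathsf{At},i}), (\mathcal{A}_{\mathsf{At},i}), V_{\mathsf{At}}\rangle$: $W_{\mathsf{At}} := S_{\mathsf{At}}$; $(\omega,\omega') \in R_{\mathsf{At},i}$ iff $\omega' \in \Lambda_i(\omega)$; $\mathcal{A}_{\mathsf{At},i}(\omega) := \mathcal{L}_\Phi$ for the $\Phi$ with $\Pi_i(\omega) \subseteq S_\Phi$; $V_{\mathsf{At}}(p) := v(p) \cap S_{\mathsf{At}}$. -}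

module Defs where

open import Level using (Level; 0ℓ; Lift) renaming (suc to lsuc)
open import Data.Product using (Σ; ∃; ∃-syntax; _×_; _,_; proj₁; proj₂)
open import Data.Sum using (_⊎_)
open import Data.Empty using (⊥)
open import Data.Unit using (⊤)
open import Relation.Binary.PropositionalEquality using (_≡_)
open import Relation.Binary.Core using (Rel)
open import Relation.Binary.Structures using (IsEquivalence)
open import Relation.Unary using (Pred; _⊆_; _≐_; _∈_; U)

data Form (At : Set) (I : Set) : Set where
  ⊤'   : Form At I
  atom : At → Form At I
  ¬'_  : Form At I → Form At I
  _∧'_ : Form At I → Form At I → Form At I
  ℓ    : I → Form At I → Form At I
  a    : I → Form At I → Form At I
  k    : I → Form At I → Form At I

_∈At_ : {At I : Set} → At → Form At I → Set
p ∈At ⊤'      = ⊥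
p ∈At atom q  = p ≡ q
p ∈At (¬' φ)  = p ∈At φ
p ∈At (φ ∧' ψ) = (p ∈At φ) ⊎ (p ∈At ψ)
p ∈At ℓ _ φ   = p ∈At φ
p ∈At a _ φ   = p ∈At φ
p ∈At k _ φ   = p ∈At φ

Sub : Set → Set₁
Sub At = Pred At 0ℓ

Lang : {At I : Set} → Sub At → Pred (Form At I) 0ℓ
Lang Φ φ = ∀ p → p ∈At φ → p ∈ Φ

record Lattice (At : Set) : Set₁ where
  field
    S        : Sub At → Set
    S-nonempty : ∀ Φ → S Φ
    r        : ∀ {Φ Ψ} → Ψ ⊆ Φ → S Φ → S Ψ
    r-surj   : ∀ {Φ Ψ} (h : Ψ ⊆ Φ) (y : S Ψ) → ∃[ x ] r h x ≡ y
    r-id     : ∀ {Φ} (h : Φ ⊆ Φ) (x : S Φ) → r h x ≡ x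
    r-comp   : ∀ {Φ Ψ Υ} (h₁ : Ψ ⊆ Φ) (h₂ : Υ ⊆ Ψ) (h₃ : Υ ⊆ Φ) (x : S Φ) →
               r h₃ x ≡ r h₂ (r h₁ x)

  Ω : Set₁
  Ω = Σ (Sub At) S

  ΩSet : Set₂
  ΩSet = Pred Ω (lsuc 0ℓ)

  InSpace : Sub At → ΩSet
  InSpace Ψ ω = proj₁ ω ≡ Ψ

  upS : (Φ : Sub At) → Pred (S Φ) 0ℓ → ΩSet
  upS Φ D (Ψ , y) = Lift (lsuc 0ℓ) (Σ (Φ ⊆ Ψ) λ h → D (r h y))

  -- D↑ for a subset D of Ω (agrees with upS when D lies in one space)
  up : ΩSet → ΩSet
  up D (Ψ , y) = ∃[ Φ ] Σ (Φ ⊆ Ψ) λ h → D (Φ , r h y)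

  -- D_Ψ : projection of D to S_Ψ (agrees with r^Φ_Ψ(D) for D ⊆ S_Φ, Ψ ⊆ Φ)
  proj : Sub At → ΩSet → ΩSet
  proj Ψ D ω' = ∃[ Φ ] Σ (Ψ ⊆ Φ) λ h → ∃[ x ] (D (Φ , x) × ((Ψ , r h x) ≡ ω'))

record CHMS (At : Set) : Set₂ where
  field
    I       : Set
    I-nonempty : I
    lattice : Lattice At
  open Lattice lattice public
  field
    Λ : I → Ω → ΩSet
    Π : I → Ω → ΩSet
    v : At → ΩSet
    v-event : ∀ p → ∃[ Φ ] Σ (Pred (S Φ) 0ℓ) λ D → v p ≐ upS Φ D
    Π-nonempty : ∀ i ω → ∃[ ω' ] ω' ∈ Π i ω
    Π-confinement : ∀ i Φ (x : S Φ) → ∃[ Ψ ] (Ψ ⊆ Φ × Π i (Φ , x) ⊆ InSpace Ψ)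
    Π-genrefl : ∀ i ω → ω ∈ up (Π i ω)
    Π-stationary : ∀ i ω ω' → ω' ∈ Π i ω → Π i ω' ≐ Π i ω
    Π-PPI : ∀ i Φ Ψ (h : Ψ ⊆ Φ) (x : S Φ) →
            up (Π i (Φ , x)) ⊆ up (Π i (Ψ , r h x))
    Π-PPK : ∀ i Φ Ψ Υ (h₁ : Υ ⊆ Ψ) (h₂ : Ψ ⊆ Φ) (x : S Φ) →
            Π i (Φ , x) ⊆ InSpace Ψ →
            proj Υ (Π i (Φ , x)) ≐ Π i (Υ , r (λ z → h₂ (h₁ z)) x)
    Λ-refl : ∀ i ω → ω ∈ Λ i ω
    Λ-stationary : ∀ i ω ω' → ω' ∈ Λ i ω → Λ i ω' ≐ Λ i ω
    Λ-PPIK : ∀ i Φ Ψ (h : Ψ ⊆ Φ) (x : S Φ) →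
             proj Ψ (Λ i (Φ , x)) ≐ Λ i (Ψ , r h x)
    explicit-measurability : ∀ i ω ω' → ω' ∈ Λ i ω → Π i ω' ≐ Π i ω
    -- S_{Π_i(ω)} is the space Ψ containing Π_i(ω)
    implicit-measurability : ∀ i ω ω' Ψ → Π i ω ⊆ InSpace Ψ → ω' ∈ Π i ω →
                             Λ i ω' ≐ proj Ψ (Λ i ω)

record IsFHModel (At I W : Set) {ℓR : Level} (R : I → Rel W ℓR)
                 (A : I → W → Pred (Form At I) 0ℓ) (V : At → Pred W ℓR)
                 : Set (lsuc ℓR) where
  field
    W-nonempty : W
    R-equivalence : ∀ i → IsEquivalence (R i)
    A-propositional : ∀ i w φ →
      (A i w φ → ∀ p → p ∈At φ → A i w (atom p)) ×
      ((∀ p → p ∈At φ → A i w (atom p)) → A i w φ)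
    A-determined : ∀ i w t → R i w t → A i w ≐ A i t

module FH {At : Set} (M : CHMS At) where
  open CHMS M

  Full : Sub At
  Full = U

  W : Set
  W = S Full

  R : I → Rel W (lsuc 0ℓ)
  R i w w' = (Full , w') ∈ Λ i (Full , w)

  -- A(ω) = L_Φ for the Φ with Π_i(ω) ⊆ S_Φ (Φ unique since Π_i(ω) ≠ ∅)
  A : I → W → Pred (Form At I) 0ℓ
  A i w = Lang (proj₁ (Π-confinement i Full w))

  V : At → Pred W (lsuc 0ℓ)
  V p w = (Full , w) ∈ v p

{-# OPTIONS --safe #-}
module Submission where

open import Defs
open import Data.Product using (∃; _×_; _,_; proj₁; proj₂)
open import Relation.Binary.PropositionalEquality using (_≡_; refl; sym; trans; subst)
open import Relation.Binary.Structures using (IsEquivalence)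
open import Relation.Unary using (Pred; _⊆_; _≐_; _∈_)

Lang-atomwise : {At I : Set} (Φ : Sub At) (φ : Form At I) →
  (Lang Φ φ → ∀ p → p ∈At φ → Lang Φ (atom {I = I} p)) ×
  ((∀ p → p ∈At φ → Lang Φ (atom {I = I} p)) → Lang Φ φ)
Lang-atomwise Φ φ =
    (λ φ∈LΦ p p∈φ q q≡p → subst (_∈ Φ) (sym q≡p) (φ∈LΦ p p∈φ))
  , (λ atoms∈LΦ p p∈φ → atoms∈LΦ p p∈φ p refl)

Lang-cong : {At I : Set} {Φ Ψ : Sub At} → Φ ≡ Ψ → Lang {I = I} Φ ≐ Lang Ψ
Lang-cong refl = (λ φ∈LΦ → φ∈LΦ) , (λ φ∈LΦ → φ∈LΦ)

cell-isEquivalence : ∀ {a b ℓ} {W : Set a} {X : Set b} (f : W → X) (T : X → Pred X ℓ) →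
  (∀ x → x ∈ T x) → (∀ x y → y ∈ T x → T y ≐ T x) →
  IsEquivalence (λ w w' → f w' ∈ T (f w))
cell-isEquivalence f T reflexive stationary = record
  { refl  = λ {w} → reflexive (f w)
  ; sym   = λ {w} {w'} w'∈Tw → proj₂ (stationary (f w) (f w') w'∈Tw) (reflexive (f w))
  ; trans = λ {w} {w'} w'∈Tw w''∈Tw' → proj₁ (stationary (f w) (f w') w'∈Tw) w''∈Tw'
  }

module _ {At : Set} (L : Lattice At) where
  open Lattice L

  InSpace-unique : ∀ {ℓ} {D : Pred Ω ℓ} {Φ Ψ} → ∃ (_∈ D) →
    D ⊆ InSpace Φ → D ⊆ InSpace Ψ → Φ ≡ Ψ
  InSpace-unique (ω , ω∈D) D⊆SΦ D⊆SΨ = trans (sym (D⊆SΦ ω∈D)) (D⊆SΨ ω∈D)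

module _ {At : Set} (M : CHMS At) where
  open CHMS M
  open FH M

  awareness-space : I → W → Sub At
  awareness-space i w = proj₁ (Π-confinement i Full w)

  awareness-space-resp-R : ∀ i w t → R i w t → awareness-space i w ≡ awareness-space i t
  awareness-space-resp-R i w t wRt =
    InSpace-unique lattice (Π-nonempty i (Full , w))
      (proj₂ (proj₂ (Π-confinement i Full w)))
      (λ ω∈Πw → proj₂ (proj₂ (Π-confinement i Full t))
                  (proj₂ (explicit-measurability i (Full , w) (Full , t) wRt) ω∈Πw))

proposition8 : {At : Set} → At → (M : CHMS At) →
    IsFHModel At (CHMS.I M) (FH.W M) (FH.R M) (FH.A M) (FH.V M)
proposition8 _ M = record
  { W-nonempty      = S-nonempty Full
  ; R-equivalence   = λ i → cell-isEquivalence (Full ,_) (Λ i) (Λ-refl i) (Λ-stationary i)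
  ; A-propositional = λ i w → Lang-atomwise (awareness-space M i w)
  ; A-determined    = λ i w t wRt → Lang-cong (awareness-space-resp-R M i w t wRt)
  }
  where
    open CHMS M
    open FH M
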